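{- Let $d\ge2$ and $\alpha=\frac{d+\sqrt{d^2+4}}{2}$. For every integer $n$, $\mathtt{nut}(n)=\lceil -n\alpha\rceil$.
   Context: Define $(D_n)_{n\in\mathbb Z}$ by $D_0=0$, $D_1=1$ and $D_{n+1}=dD_n+D_{n-1}$ for all $n\in\mathbb Z$ (so $D_{ -n}=(-1)^{n+1}D_n$). Dual Ostrowski numeration: every integer $N$ has a unique representation $N=\sum_{j=1}^i d_jD_{ -j}$ with digits $d_j\in\{0,1,\dots,d\}$, $d_i\neq0$ (empty sum for $N=0$), such that every digit equal to $d$ other than the last one is followed by $0$ (i.e. $d_j=d$ with $j<i$ implies $d_{j+1}=0$). For an integer $N$ with this representation, $\mathtt{nut}(N)=\sum_{j=1}^i d_jD_{ -j-1}$ (shifting the digits by one position), and $\mathtt{nut}(0)=0$. -}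

module Defs where

open import Data.Nat as ℕ using (ℕ; zero; suc)
open import Data.Integer using (ℤ; +_; _+_; _-_; _*_; -_; _≤_; _<_; _>_; _≥_)
open import Data.List using (List; []; _∷_)
open import Data.Product using (_×_)
open import Data.Sum using (_⊎_)
open import Data.Empty using (⊥)
open import Relation.Binary.PropositionalEquality using (_≡_)
open import Relation.Nullary using (¬_)

Dpos : ℕ → ℕ → ℤ
Dpos d zero = + 0
Dpos d (suc zero) = + 1
Dpos d (suc (suc k)) = + d * Dpos d (suc k) + Dpos d k

-- Dneg d k = D_{-k}, obtained from the same recurrence run backwards:
-- D_{n-1} = D_{n+1} - d D_n.  So D_0 = 0, D_{-1} = D_1 - d D_0 = 1,
-- D_{-(k+2)} = D_{-k} - d D_{-(k+1)}.
Dneg : ℕ → ℕ → ℤ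
Dneg d zero = + 0
Dneg d (suc zero) = + 1
Dneg d (suc (suc k)) = Dneg d k - + d * Dneg d (suc k)

data Valid (d : ℕ) : List ℕ → Set where
  nil  : Valid d []
  last : ∀ {x} → x ℕ.≤ d → ¬ (x ≡ 0) → Valid d (x ∷ [])
  cons : ∀ {x y ys} → x ℕ.≤ d → (x ≡ d → y ≡ 0) → Valid d (y ∷ ys) →
         Valid d (x ∷ y ∷ ys)

valueFrom : ℕ → ℕ → List ℕ → ℤ
valueFrom d j [] = + 0
valueFrom d j (x ∷ xs) = + x * Dneg d j + valueFrom d (suc j) xs

value : ℕ → List ℕ → ℤ
value d ds = valueFrom d 1 ds

nutValue : ℕ → List ℕ → ℤ
nutValue d ds = valueFrom d 2 ds

-- Exact comparisons of a·√D with an integer b (D ≥ 0, √D ≥ 0 the real square root),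
-- decided by squaring with the appropriate sign cases.
-- a·√D ≤ b
SqrtLe : ℤ → ℕ → ℤ → Set
SqrtLe a D b =
  (a ≤ + 0 × (b ≥ + 0 ⊎ (b < + 0 × b * b ≤ a * a * + D)))
  ⊎ (a > + 0 × (b ≥ + 0 × a * a * + D ≤ b * b))

SqrtLt : ℤ → ℕ → ℤ → Set
SqrtLt a D b =
  (a ≤ + 0 × (b > + 0 ⊎ (b ≤ + 0 × b * b < a * a * + D)))
  ⊎ (a > + 0 × (b > + 0 × a * a * + D < b * b))

-- With s = √(d²+4) and α = (d + s)/2, the integer m equals ⌈-nα⌉, i.e.
--   m - 1 < -nα ≤ m.
-- -nα ≤ m      ⇔  (-n)·s ≤ 2m + n d
-- m - 1 < -nα  ⇔  n·s < 2 - n d - 2m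
IsCeilNegNAlpha : ℕ → ℤ → ℤ → Set
IsCeilNegNAlpha d n m =
  SqrtLe (- n) (d ℕ.* d ℕ.+ 4) (+ 2 * m + n * + d)
  × SqrtLt n (d ℕ.* d ℕ.+ 4) (+ 2 - n * + d - + 2 * m)

{-# OPTIONS --safe #-}
-- Write θ(xs) = nutValue xs + value xs · α in ℤ[α], where α² = d·α + 1.  Prepending a
-- digit gives θ(x ∷ xs) = (x + θ(xs))/α, so along a valid representation 0 ≤ θ < 1: for
-- x < d since x + 1 ≤ d < α, and for x = d since the next digit, if any, is 0, which forces
-- θ(xs) < 1/α = α − d.  For n = value xs this says exactly nutValue xs = ⌈−nα⌉.  Signs in
-- ℤ[α] are decided by norm and trace, which needs the irrationality of √(d²+4); it follows
-- by descent.
--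
-- For existence, the values of digit strings of length k (trailing zeros allowed) whose last
-- digit is at most d, resp. at most d − 1, cover two integer intervals.  A digit y in position
-- k + 1 shifts the second interval by y·D₋₍ₖ₊₁₎, and together with the first interval these
-- shifts cover the next one, which grows alternately upwards and downwards.  Since D_k grows,
-- every integer is reached.
module Submission where

open import Defs
open import Data.Nat as ℕ using (ℕ; zero; suc; z≤n; s≤s; _∸_; _≥_)
import Data.Nat.Properties as ℕₚ
open import Data.Empty using (⊥-elim)
open import Data.List using (List; []; _∷_)
open import Data.Sum using (_⊎_; inj₁; inj₂)
open import Data.Product using (Σ; _×_; _,_; proj₁; proj₂)
open import Relation.Binary.PropositionalEquality
  using (_≡_; refl; sym; trans; cong; cong₂; subst; subst₂; module ≡-Reasoning)

module SquareRootIrrational where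
  open import Data.Nat using (_+_; _*_; _≤_; _<_; NonZero; >-nonZero)
  open import Data.Nat.Properties
  open import Data.Nat.Induction using (<-rec)
  open import Data.Nat.Tactic.RingSolver using (solve)

  *-self-cancel-≤ : ∀ m n → m * m ≤ n * n → m ≤ n
  *-self-cancel-≤ m n m²≤n² with ≤-<-connex m n
  ... | inj₁ m≤n = m≤n
  ... | inj₂ n<m = ⊥-elim (<⇒≱ (*-mono-< n<m n<m) m²≤n²)

  module _ {d : ℕ} (1≤d : 1 ≤ d) where

    u[u+dv]≡v²⇒du≤v : ∀ u v .{{_ : NonZero v}} → u * (u + d * v) ≡ v * v → d * u ≤ v
    u[u+dv]≡v²⇒du≤v u v eq = *-cancelʳ-≤ (d * u) v v (begin
      d * u * v           ≤⟨ m≤n+m (d * u * v) (u * u) ⟩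
      u * u + d * u * v   ≡⟨ solve (d ∷ u ∷ v ∷ []) ⟩
      u * (u + d * v)     ≡⟨ eq ⟩
      v * v               ∎)
      where open ≤-Reasoning

    descent-step : ∀ u r → u * (u + d * (d * u + r)) ≡ (d * u + r) * (d * u + r) →
                   r * (r + d * u) ≡ u * u
    descent-step u r eq = +-cancelʳ-≡ (d * u * (d * u + r)) _ _ (begin
      r * (r + d * u) + d * u * (d * u + r) ≡⟨ solve (d ∷ u ∷ r ∷ []) ⟩
      (d * u + r) * (d * u + r)             ≡⟨ eq ⟨
      u * (u + d * (d * u + r))             ≡⟨ solve (d ∷ u ∷ r ∷ []) ⟩
      u * u + d * u * (d * u + r)           ∎)
      where open ≡-Reasoning

    -- (v ∸ d·u, u) is again a solution, with a smaller second component unless v = 0.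
    u[u+dv]≡v²⇒v≡0 : ∀ v u → u * (u + d * v) ≡ v * v → v ≡ 0
    u[u+dv]≡v²⇒v≡0 = <-rec _ descent
      where
      descent : ∀ v → (∀ {w} → w < v → ∀ u → u * (u + d * w) ≡ w * w → w ≡ 0) →
                ∀ u → u * (u + d * v) ≡ v * v → v ≡ 0
      descent zero      _   _         _  = refl
      descent (suc _)   _   zero      ()
      descent v@(suc _) rec u@(suc _) eq = ⊥-elim (1+n≢0 (rec u<v r eq′))
        where
        r : ℕ
        r = v ∸ d * u
        du+r≡v : d * u + r ≡ v
        du+r≡v = m+[n∸m]≡n (u[u+dv]≡v²⇒du≤v u v eq)
        eq′ : r * (r + d * u) ≡ u * u
        eq′ = descent-step u r (subst (λ v → u * (u + d * v) ≡ v * v) (sym du+r≡v) eq)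
        0<r : 0 < r
        0<r with r | eq′
        ... | suc _ | _ = s≤s z≤n
        u<v : u < v
        u<v = subst (u <_) du+r≡v
                (≤-<-trans (m≤n*m u d {{>-nonZero 1≤d}}) (m<m+n (d * u) 0<r))

    completing-square : ∀ y c → (y * d + c) * (y * d + c) ≡ y * y * (d * d + 4) →
                        c * (c + d * (2 * y)) ≡ 2 * y * (2 * y)
    completing-square y c eq = +-cancelʳ-≡ (y * d * (y * d)) _ _ (begin
      c * (c + d * (2 * y)) + y * d * (y * d) ≡⟨ solve (d ∷ y ∷ c ∷ []) ⟩
      (y * d + c) * (y * d + c)               ≡⟨ eq ⟩
      y * y * (d * d + 4)                     ≡⟨ solve (d ∷ y ∷ []) ⟩
      2 * y * (2 * y) + y * d * (y * d)       ∎)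
      where open ≡-Reasoning

    x²≡y²[d²+4]⇒y≡0 : ∀ x y → x * x ≡ y * y * (d * d + 4) → y ≡ 0
    x²≡y²[d²+4]⇒y≡0 x y eq =
      m*n≡0⇒m≡0 y 2 (trans (*-comm y 2) (u[u+dv]≡v²⇒v≡0 (2 * y) c (completing-square y c eq′)))
      where
      yd≤x : y * d ≤ x
      yd≤x = *-self-cancel-≤ (y * d) x (begin
        y * d * (y * d)     ≡⟨ solve (d ∷ y ∷ []) ⟩
        y * y * (d * d)     ≤⟨ *-monoʳ-≤ (y * y) (m≤m+n (d * d) 4) ⟩
        y * y * (d * d + 4) ≡⟨ eq ⟨
        x * x               ∎)
        where open ≤-Reasoning
      c : ℕ
      c = x ∸ y * d
      eq′ : (y * d + c) * (y * d + c) ≡ y * y * (d * d + 4)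
      eq′ = subst (λ x → x * x ≡ y * y * (d * d + 4)) (sym (m+[n∸m]≡n yd≤x)) eq

open SquareRootIrrational using (x²≡y²[d²+4]⇒y≡0)
open import Data.Integer as ℤ
  using (ℤ; +_; -[1+_]; _+_; _-_; _*_; -_; _≤_; _<_; ∣_∣; +<+; 0ℤ; 1ℤ; -1ℤ)
import Data.Integer.Properties as ℤₚ
open import Data.Integer.Tactic.RingSolver using (solve-∀)
open import Relation.Binary.Definitions using (tri<; tri≈; tri>)
open import Relation.Nullary using (yes; no)

0≤i*j : ∀ {i j} → 0ℤ ≤ i → 0ℤ ≤ j → 0ℤ ≤ i * j
0≤i*j {j = j} 0≤i 0≤j = ℤₚ.*-monoʳ-≤-nonNeg j {{ℤ.nonNegative 0≤j}} 0≤i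

0≤i*i : ∀ i → 0ℤ ≤ i * i
0≤i*i i with ℤₚ.≤-total 0ℤ i
... | inj₁ 0≤i = ℤₚ.*-monoʳ-≤-nonNeg i {{ℤ.nonNegative 0≤i}} 0≤i
... | inj₂ i≤0 = ℤₚ.*-monoʳ-≤-nonPos i {{ℤ.nonPositive i≤0}} i≤0

*-self-anti-≤ : ∀ {i j} → i ≤ j → j ≤ 0ℤ → j * j ≤ i * i
*-self-anti-≤ {i} {j} i≤j j≤0 = ℤₚ.≤-trans
  (ℤₚ.*-monoʳ-≤-nonPos j {{ℤ.nonPositive j≤0}} i≤j)
  (ℤₚ.*-monoˡ-≤-nonPos i {{ℤ.nonPositive (ℤₚ.≤-trans i≤j j≤0)}} i≤j)

0<i*j-k*k⇒0<i+j⇒0<i : ∀ {i j k} → 0ℤ < i * j - k * k → 0ℤ < i + j → 0ℤ < i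
0<i*j-k*k⇒0<i+j⇒0<i {i} {j} {k} 0<ij-k² 0<i+j with 0ℤ ℤₚ.<? i | 0ℤ ℤₚ.≤? j
... | yes 0<i | _       = 0<i
... | no  i≯0 | yes 0≤j =
  ⊥-elim (ℤₚ.<⇒≱ 0<ij (ℤₚ.*-monoʳ-≤-nonNeg j {{ℤ.nonNegative 0≤j}} (ℤₚ.≮⇒≥ i≯0)))
  where
  0<ij : 0ℤ < i * j
  0<ij = ℤₚ.<-≤-trans 0<ij-k² (ℤₚ.i-j≤i (i * j) (k * k) {{ℤ.nonNegative (0≤i*i k)}})
... | no  i≯0 | no  j≱0 =
  ⊥-elim (ℤₚ.<⇒≱ 0<i+j (ℤₚ.<⇒≤ (ℤₚ.+-mono-≤-< (ℤₚ.≮⇒≥ i≯0) (ℤₚ.≰⇒> j≱0))))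

0<i⇒2i≤j⇒0<k*k+i*j-i*i : ∀ {i j k} → 0ℤ < i → + 2 * i ≤ j → 0ℤ < k * k + i * j - i * i
0<i⇒2i≤j⇒0<k*k+i*j-i*i {i} {j} {k} 0<i 2i≤j = begin-strict
  0ℤ                            <⟨ ℤₚ.*-monoʳ-<-pos i {{ℤ.positive 0<i}} 0<i ⟩
  i * i                         ≤⟨ ℤₚ.i≤j+i (i * i) (k * k) {{ℤ.nonNegative (0≤i*i k)}} ⟩
  k * k + i * i                 ≡⟨ identity i k ⟩
  k * k + i * (+ 2 * i) - i * i ≤⟨ ℤₚ.+-monoˡ-≤ (- (i * i)) (ℤₚ.+-monoʳ-≤ (k * k) i*2i≤i*j) ⟩
  k * k + i * j - i * i         ∎
  where
  open ℤₚ.≤-Reasoning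
  identity : ∀ i k → k * k + i * i ≡ k * k + i * (+ 2 * i) - i * i
  identity = solve-∀
  i*2i≤i*j : i * (+ 2 * i) ≤ i * j
  i*2i≤i*j = ℤₚ.*-monoˡ-≤-nonNeg i {{ℤ.nonNegative (ℤₚ.<⇒≤ 0<i)}} 2i≤j

∣i∣<j⇒1-j≤i≤j : ∀ i {j} → + ∣ i ∣ < j → 1ℤ - j ≤ i × i ≤ j
∣i∣<j⇒1-j≤i≤j i {j} ∣i∣<j = ℤₚ.≤-trans 1-j≤-∣i∣ (-∣i∣≤i i) , ℤₚ.≤-trans (i≤∣i∣ i) (ℤₚ.<⇒≤ ∣i∣<j)
  where
  -∣i∣≤i : ∀ i → - + ∣ i ∣ ≤ i
  -∣i∣≤i (+ n)    = ℤₚ.neg-≤-pos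
  -∣i∣≤i -[1+ n ] = ℤₚ.≤-refl
  i≤∣i∣ : ∀ i → i ≤ + ∣ i ∣
  i≤∣i∣ (+ n)    = ℤₚ.≤-refl
  i≤∣i∣ -[1+ n ] = ℤ.-≤+
  identity : ∀ m → 1ℤ + - (1ℤ + m) ≡ - m
  identity = solve-∀
  1-j≤-∣i∣ : 1ℤ - j ≤ - + ∣ i ∣
  1-j≤-∣i∣ = subst (1ℤ - j ≤_) (identity (+ ∣ i ∣))
               (ℤₚ.+-monoʳ-≤ 1ℤ (ℤₚ.neg-mono-≤ (ℤₚ.i<j⇒suc[i]≤j ∣i∣<j)))

SqrtLt⇒SqrtLe : ∀ {a D b} → SqrtLt a D b → SqrtLe a D b
SqrtLt⇒SqrtLe (inj₁ (a≤0 , inj₁ b>0)) = inj₁ (a≤0 , inj₁ (ℤₚ.<⇒≤ b>0))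
SqrtLt⇒SqrtLe {b = b} (inj₁ (a≤0 , inj₂ (b≤0 , b²<a²D))) with 0ℤ ℤₚ.≤? b
... | yes b≥0 = inj₁ (a≤0 , inj₁ b≥0)
... | no  b≱0 = inj₁ (a≤0 , inj₂ (ℤₚ.≰⇒> b≱0 , ℤₚ.<⇒≤ b²<a²D))
SqrtLt⇒SqrtLe (inj₂ (a>0 , b>0 , a²D<b²)) = inj₂ (a>0 , ℤₚ.<⇒≤ b>0 , ℤₚ.<⇒≤ a²D<b²)

module QuadraticInteger (d : ℕ) where

  -- ⟨ b , a ⟩ stands for b + a·α with α = (d + √(d²+4))/2, a root of α² = d·α + 1.
  record ℤ[α] : Set where
    constructor ⟨_,_⟩
    field
      re im : ℤ
  open ℤ[α] public

  δ E : ℤ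
  δ = + d
  E = + (d ℕ.* d ℕ.+ 4)

  infixl 6 _+ℤ_
  infix 8 _*α _/α

  _+ℤ_ : ℤ[α] → ℤ → ℤ[α]
  ⟨ b , a ⟩ +ℤ k = ⟨ b + k , a ⟩

  _*α : ℤ[α] → ℤ[α]
  ⟨ b , a ⟩ *α = ⟨ a , b + a * δ ⟩

  _/α : ℤ[α] → ℤ[α]
  ⟨ b , a ⟩ /α = ⟨ a - b * δ , b ⟩

  1-_ : ℤ[α] → ℤ[α]
  1- ⟨ b , a ⟩ = ⟨ 1ℤ - b , - a ⟩

  norm : ℤ[α] → ℤ
  norm ⟨ b , a ⟩ = b * b + a * b * δ - a * a

  trace : ℤ[α] → ℤ
  trace ⟨ b , a ⟩ = + 2 * b + a * δ

  trace²≡4norm+im²E : ∀ z → trace z * trace z ≡ + 4 * norm z + im z * im z * E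
  trace²≡4norm+im²E z@(⟨ b , a ⟩) =
    trans (identity δ b a) (cong (λ e → + 4 * norm z + a * a * e) δ²+4≡E)
    where
    identity : ∀ δ b a → (+ 2 * b + a * δ) * (+ 2 * b + a * δ) ≡
                         + 4 * (b * b + a * b * δ - a * a) + a * a * (δ * δ + + 4)
    identity = solve-∀
    δ²+4≡E : δ * δ + + 4 ≡ E
    δ²+4≡E = sym (trans (ℤₚ.pos-+ (d ℕ.* d) 4) (cong (_+ + 4) (ℤₚ.pos-* d d)))

  norm≡0⇒im≡0 : 1 ℕ.≤ d → ∀ z → norm z ≡ 0ℤ → im z ≡ 0ℤ
  norm≡0⇒im≡0 1≤d z N≡0 = ℤₚ.∣i∣≡0⇒i≡0 (x²≡y²[d²+4]⇒y≡0 1≤d ∣ trace z ∣ ∣ im z ∣ (begin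
    ∣ trace z ∣ ℕ.* ∣ trace z ∣   ≡⟨ ℤₚ.abs-* (trace z) (trace z) ⟨
    ∣ trace z * trace z ∣         ≡⟨ cong ∣_∣ (trace²≡4norm+im²E z) ⟩
    ∣ + 4 * norm z + a²E ∣        ≡⟨ cong (λ n → ∣ + 4 * n + a²E ∣) N≡0 ⟩
    ∣ 0ℤ + a²E ∣                  ≡⟨ cong ∣_∣ (ℤₚ.+-identityˡ a²E) ⟩
    ∣ im z * im z * E ∣           ≡⟨ ℤₚ.abs-* (im z * im z) E ⟩
    ∣ im z * im z ∣ ℕ.* ∣ E ∣     ≡⟨ cong (ℕ._* ∣ E ∣) (ℤₚ.abs-* (im z) (im z)) ⟩
    ∣ im z ∣ ℕ.* ∣ im z ∣ ℕ.* (d ℕ.* d ℕ.+ 4) ∎))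
    where
    open ≡-Reasoning
    a²E : ℤ
    a²E = im z * im z * E

  -- Positive z means z > 0 as a real number.  With ᾱ = −1/α the other root, z and its conjugate
  -- z̄ = re z + im z·ᾱ have product norm z, sum trace z and difference z − z̄ = im z·√(d²+4).
  data Positive (z : ℤ[α]) : Set where
    totally-positive   : 0ℤ < norm z → 0ℤ < trace z → Positive z
    conjugate-negative : norm z < 0ℤ → 0ℤ < im z → Positive z

  im²E<trace² : ∀ z → 0ℤ < norm z → im z * im z * E < trace z * trace z
  im²E<trace² z N>0 =
    subst₂ _<_ (ℤₚ.+-identityˡ (im z * im z * E)) (sym (trace²≡4norm+im²E z))
      (ℤₚ.+-monoˡ-< (im z * im z * E) (ℤₚ.*-monoˡ-<-pos (+ 4) N>0))

  trace²<im²E : ∀ z → norm z < 0ℤ → trace z * trace z < im z * im z * E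
  trace²<im²E z N<0 =
    subst₂ _<_ (sym (trace²≡4norm+im²E z)) (ℤₚ.+-identityˡ (im z * im z * E))
      (ℤₚ.+-monoˡ-< (im z * im z * E) (ℤₚ.*-monoˡ-<-pos (+ 4) N<0))

  positive-ℤ : ∀ {k} → 0ℤ < k → Positive ⟨ k , 0ℤ ⟩
  positive-ℤ {k} 0<k = totally-positive
    (subst (0ℤ <_) (sym (norm≡ δ k)) (ℤₚ.*-monoʳ-<-pos k {{ℤ.positive 0<k}} 0<k))
    (subst (0ℤ <_) (sym (trace≡ δ k)) (ℤₚ.*-monoˡ-<-pos (+ 2) 0<k))
    where
    norm≡ : ∀ δ k → k * k + 0ℤ * k * δ - 0ℤ * 0ℤ ≡ k * k
    norm≡ = solve-∀
    trace≡ : ∀ δ k → + 2 * k + 0ℤ * δ ≡ + 2 * k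
    trace≡ = solve-∀

  norm-+ℤ : ∀ z k → norm (z +ℤ k) ≡ norm z + k * trace z + k * k
  norm-+ℤ ⟨ b , a ⟩ k = identity δ b a k
    where
    identity : ∀ δ b a k → (b + k) * (b + k) + a * (b + k) * δ - a * a ≡
                           (b * b + a * b * δ - a * a) + k * (+ 2 * b + a * δ) + k * k
    identity = solve-∀

  trace-+ℤ : ∀ z k → trace (z +ℤ k) ≡ trace z + + 2 * k
  trace-+ℤ ⟨ b , a ⟩ k = identity δ b a k
    where
    identity : ∀ δ b a k → + 2 * (b + k) + a * δ ≡ (+ 2 * b + a * δ) + + 2 * k
    identity = solve-∀

  norm-/α : ∀ z → norm (z /α) ≡ - norm z
  norm-/α ⟨ b , a ⟩ = identity δ b a
    where
    identity : ∀ δ b a → (a - b * δ) * (a - b * δ) + b * (a - b * δ) * δ - b * b ≡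
                         - (b * b + a * b * δ - a * a)
    identity = solve-∀

  norm-*α : ∀ z → norm (z *α) ≡ - norm z
  norm-*α ⟨ b , a ⟩ = identity δ b a
    where
    identity : ∀ δ b a → a * a + (b + a * δ) * a * δ - (b + a * δ) * (b + a * δ) ≡
                         - (b * b + a * b * δ - a * a)
    identity = solve-∀

  positive-+ℤ : 1 ℕ.≤ d → ∀ {z k} → Positive z → 0ℤ ≤ k → Positive (z +ℤ k)
  positive-+ℤ _ {z} {k} (totally-positive N>0 T>0) 0≤k = totally-positive
    (subst (0ℤ <_) (sym (norm-+ℤ z k))
      (ℤₚ.+-mono-<-≤ (ℤₚ.+-mono-<-≤ N>0 (0≤i*j 0≤k (ℤₚ.<⇒≤ T>0))) (0≤i*i k)))
    (subst (0ℤ <_) (sym (trace-+ℤ z k)) (ℤₚ.+-mono-<-≤ T>0 (0≤i*j {+ 2} (ℤ.+≤+ z≤n) 0≤k)))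
  positive-+ℤ 1≤d {z} {k} (conjugate-negative N<0 a>0) 0≤k with ℤₚ.<-cmp (norm (z +ℤ k)) 0ℤ
  ... | tri< N′<0 _ _ = conjugate-negative N′<0 a>0
  ... | tri≈ _ N′≡0 _ = ⊥-elim (ℤₚ.<-irrefl (sym (norm≡0⇒im≡0 1≤d (z +ℤ k) N′≡0)) a>0)
  ... | tri> _ _ N′>0 = totally-positive N′>0 T′>0
    where
    -- Otherwise trace z ≤ trace (z +ℤ k) ≤ 0, so the squared traces, hence the norms, compare
    -- the wrong way round.
    T′>0 : 0ℤ < trace (z +ℤ k)
    T′>0 with 0ℤ ℤₚ.<? trace (z +ℤ k)
    ... | yes T′>0 = T′>0
    ... | no  T′≯0 = ⊥-elim (ℤₚ.<-irrefl refl (begin-strict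
      im z * im z * E                   <⟨ im²E<trace² (z +ℤ k) N′>0 ⟩
      trace (z +ℤ k) * trace (z +ℤ k)   ≤⟨ *-self-anti-≤ T≤T′ (ℤₚ.≮⇒≥ T′≯0) ⟩
      trace z * trace z                 <⟨ trace²<im²E z N<0 ⟩
      im z * im z * E                   ∎))
      where
      open ℤₚ.≤-Reasoning
      T≤T′ : trace z ≤ trace (z +ℤ k)
      T≤T′ = subst (trace z ≤_) (sym (trace-+ℤ z k))
               (ℤₚ.i≤i+j (trace z) (+ 2 * k) {{ℤ.nonNegative (0≤i*j {+ 2} (ℤ.+≤+ z≤n) 0≤k)}})

  positive-/α : ∀ {z} → Positive z → Positive (z /α)
  positive-/α {z@(⟨ b , a ⟩)} (totally-positive N>0 T>0) = conjugate-negative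
    (subst (_< 0ℤ) (sym (norm-/α z)) (ℤₚ.neg-mono-< N>0))
    (0<i*j-k*k⇒0<i+j⇒0<i {b} {b + a * δ} {a}
      (subst (0ℤ <_) (norm≡ δ b a) N>0) (subst (0ℤ <_) (trace≡ δ b a) T>0))
    where
    norm≡ : ∀ δ b a → b * b + a * b * δ - a * a ≡ b * (b + a * δ) - a * a
    norm≡ = solve-∀
    trace≡ : ∀ δ b a → + 2 * b + a * δ ≡ b + (b + a * δ)
    trace≡ = solve-∀
  positive-/α {z@(⟨ b , a ⟩)} (conjugate-negative N<0 a>0) = totally-positive
    (subst (0ℤ <_) (sym (norm-/α z)) (ℤₚ.neg-mono-< N<0)) T′>0
    where
    T′>0 : 0ℤ < trace (z /α)
    T′>0 with 0ℤ ℤₚ.<? trace (z /α)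
    ... | yes T′>0 = T′>0
    ... | no  T′≯0 = ⊥-elim (ℤₚ.<-asym N<0
                      (subst (0ℤ <_) (norm≡ δ b a) (0<i⇒2i≤j⇒0<k*k+i*j-i*i {a} {b * δ} {b} a>0 2a≤bδ)))
      where
      trace≡ : ∀ δ b a → + 2 * (a - b * δ) + b * δ ≡ + 2 * a - b * δ
      trace≡ = solve-∀
      norm≡ : ∀ δ b a → b * b + a * (b * δ) - a * a ≡ b * b + a * b * δ - a * a
      norm≡ = solve-∀
      2a≤bδ : + 2 * a ≤ b * δ
      2a≤bδ = ℤₚ.i-j≤0⇒i≤j (subst (_≤ 0ℤ) (trace≡ δ b a) (ℤₚ.≮⇒≥ T′≯0))

  positive-*α : ∀ {z} → Positive z → Positive (z *α)
  positive-*α {z@(⟨ b , a ⟩)} (totally-positive N>0 T>0) = conjugate-negative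
    (subst (_< 0ℤ) (sym (norm-*α z)) (ℤₚ.neg-mono-< N>0))
    (0<i*j-k*k⇒0<i+j⇒0<i {b + a * δ} {b} {a}
      (subst (0ℤ <_) (norm≡ δ b a) N>0) (subst (0ℤ <_) (trace≡ δ b a) T>0))
    where
    norm≡ : ∀ δ b a → b * b + a * b * δ - a * a ≡ (b + a * δ) * b - a * a
    norm≡ = solve-∀
    trace≡ : ∀ δ b a → + 2 * b + a * δ ≡ (b + a * δ) + b
    trace≡ = solve-∀
  positive-*α {z@(⟨ b , a ⟩)} (conjugate-negative N<0 a>0) = totally-positive
    (subst (0ℤ <_) (sym (norm-*α z)) (ℤₚ.neg-mono-< N<0)) T′>0
    where
    c : ℤ
    c = b + a * δ
    T′>0 : 0ℤ < trace (z *α)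
    T′>0 with 0ℤ ℤₚ.<? trace (z *α)
    ... | yes T′>0 = T′>0
    ... | no  T′≯0 = ⊥-elim (ℤₚ.<-asym N<0
                      (subst (0ℤ <_) (norm≡ δ b a) (0<i⇒2i≤j⇒0<k*k+i*j-i*i {a} { - (c * δ)} {c} a>0 2a≤-cδ)))
      where
      trace≡ : ∀ δ b a → + 2 * a + (b + a * δ) * δ ≡ + 2 * a - - ((b + a * δ) * δ)
      trace≡ = solve-∀
      norm≡ : ∀ δ b a → (b + a * δ) * (b + a * δ) + a * - ((b + a * δ) * δ) - a * a ≡
                        b * b + a * b * δ - a * a
      norm≡ = solve-∀
      2a≤-cδ : + 2 * a ≤ - (c * δ)
      2a≤-cδ = ℤₚ.i-j≤0⇒i≤j (subst (_≤ 0ℤ) (trace≡ δ b a) (ℤₚ.≮⇒≥ T′≯0))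

  NonNegative : ℤ[α] → Set
  NonNegative z = z ≡ ⟨ 0ℤ , 0ℤ ⟩ ⊎ Positive z

  nonNegative-+ℤ : 1 ℕ.≤ d → ∀ {z k} → NonNegative z → 0ℤ ≤ k → NonNegative (z +ℤ k)
  nonNegative-+ℤ _   {k = + zero}  (inj₁ refl) _   = inj₁ refl
  nonNegative-+ℤ _   {k = + suc _} (inj₁ refl) _   = inj₂ (positive-ℤ (+<+ (s≤s z≤n)))
  nonNegative-+ℤ 1≤d               (inj₂ z>0)  0≤k = inj₂ (positive-+ℤ 1≤d z>0 0≤k)

  nonNegative-/α : ∀ {z} → NonNegative z → NonNegative (z /α)
  nonNegative-/α (inj₁ refl) = inj₁ refl
  nonNegative-/α (inj₂ z>0)  = inj₂ (positive-/α z>0)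

  private
    neg²≡² : ∀ a e → - a * - a * e ≡ a * a * e
    neg²≡² = solve-∀

  positive⇒SqrtLt : ∀ {b a} → Positive ⟨ b , a ⟩ → SqrtLt (- a) (d ℕ.* d ℕ.+ 4) (trace ⟨ b , a ⟩)
  positive⇒SqrtLt {b} {a} (totally-positive N>0 T>0) with 0ℤ ℤₚ.≤? a
  ... | yes 0≤a = inj₁ (ℤₚ.neg-mono-≤ 0≤a , inj₁ T>0)
  ... | no  0≰a = inj₂ (ℤₚ.neg-mono-< (ℤₚ.≰⇒> 0≰a) , T>0 ,
                        subst (_< T * T) (sym (neg²≡² a E)) (im²E<trace² ⟨ b , a ⟩ N>0))
    where
    T : ℤ
    T = trace ⟨ b , a ⟩
  positive⇒SqrtLt {b} {a} (conjugate-negative N<0 a>0) with 0ℤ ℤₚ.<? trace ⟨ b , a ⟩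
  ... | yes T>0 = inj₁ (ℤₚ.<⇒≤ (ℤₚ.neg-mono-< a>0) , inj₁ T>0)
  ... | no  T≯0 = inj₁ (ℤₚ.<⇒≤ (ℤₚ.neg-mono-< a>0) , inj₂ (ℤₚ.≮⇒≥ T≯0 ,
                        subst (T * T <_) (sym (neg²≡² a E)) (trace²<im²E ⟨ b , a ⟩ N<0)))
    where
    T : ℤ
    T = trace ⟨ b , a ⟩

  nonNegative⇒SqrtLe : ∀ {b a} → NonNegative ⟨ b , a ⟩ →
                       SqrtLe (- a) (d ℕ.* d ℕ.+ 4) (trace ⟨ b , a ⟩)
  nonNegative⇒SqrtLe (inj₁ refl) = inj₁ (ℤₚ.≤-refl , inj₁ ℤₚ.≤-refl)
  nonNegative⇒SqrtLe (inj₂ z>0)  = SqrtLt⇒SqrtLe (positive⇒SqrtLt z>0)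

module NutValue (d : ℕ) where
  open QuadraticInteger d

  valueFrom-step : ∀ j xs →
                   valueFrom d (2 ℕ.+ j) xs ≡ valueFrom d j xs - δ * valueFrom d (1 ℕ.+ j) xs
  valueFrom-step j []       = identity δ
    where
    identity : ∀ δ → 0ℤ ≡ 0ℤ - δ * 0ℤ
    identity = solve-∀
  valueFrom-step j (x ∷ xs) = trans
    (cong (λ v → + x * Dneg d (2 ℕ.+ j) + v) (valueFrom-step (suc j) xs))
    (identity δ (+ x) (Dneg d j) (Dneg d (1 ℕ.+ j)) (valueFrom d (1 ℕ.+ j) xs) (valueFrom d (2 ℕ.+ j) xs))
    where
    identity : ∀ δ x D₀ D₁ V₁ V₂ →
               x * (D₀ - δ * D₁) + (V₁ - δ * V₂) ≡ (x * D₀ + V₁) - δ * (x * D₁ + V₂)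
    identity = solve-∀

  θ : List ℕ → ℤ[α]
  θ xs = ⟨ nutValue d xs , value d xs ⟩

  θ-∷ : ∀ x xs → θ (x ∷ xs) ≡ (θ xs +ℤ + x) /α
  θ-∷ x xs = cong₂ ⟨_,_⟩
    (trans (cong (λ v → + x * Dneg d 2 + v) (valueFrom-step 1 xs))
           (identity₁ δ (+ x) (value d xs) (nutValue d xs)))
    (identity₂ (+ x) (nutValue d xs))
    where
    identity₁ : ∀ δ x V W → x * (0ℤ - δ * 1ℤ) + (V - δ * W) ≡ V - (W + x) * δ
    identity₁ = solve-∀
    identity₂ : ∀ x W → x * 1ℤ + W ≡ W + x
    identity₂ = solve-∀

  θ-d∷0∷ : ∀ xs → θ (d ∷ 0 ∷ xs) ≡ (θ xs /α +ℤ δ) /α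
  θ-d∷0∷ xs = trans (θ-∷ d (0 ∷ xs)) (cong (λ z → (z +ℤ δ) /α) (trans (θ-∷ 0 xs)
    (cong (λ b → ⟨ b , value d xs ⟩ /α) (ℤₚ.+-identityʳ (nutValue d xs)))))

  InUnitInterval : ℤ[α] → Set
  InUnitInterval z = NonNegative z × Positive (1- z)

  inUnitInterval-0 : InUnitInterval ⟨ 0ℤ , 0ℤ ⟩
  inUnitInterval-0 = inj₁ refl , positive-ℤ (+<+ (s≤s z≤n))

  module _ (1≤d : 1 ℕ.≤ d) where

    -- 1 − (z + x)/α = (((1 − z)·α + 1)/α + (d − 1 − x))/α, because α = d + 1/α.
    inUnitInterval-digit : ∀ {z x} → x ℕ.< d → InUnitInterval z → InUnitInterval ((z +ℤ + x) /α)
    inUnitInterval-digit {z@(⟨ b , a ⟩)} {x} x<d (z≥0 , 1-z>0) =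
      nonNegative-/α (nonNegative-+ℤ 1≤d z≥0 (ℤ.+≤+ z≤n)) ,
      subst Positive (cong₂ ⟨_,_⟩ (identity₁ δ b a (+ x)) (identity₂ δ b a (+ x)))
        (positive-/α (positive-+ℤ 1≤d (positive-/α [1-z]α+1>0) 0≤d-1-x))
      where
      [1-z]α+1>0 : Positive ((1- z) *α +ℤ 1ℤ)
      [1-z]α+1>0 = positive-+ℤ 1≤d (positive-*α 1-z>0) (ℤ.+≤+ z≤n)
      0≤d-1-x : 0ℤ ≤ δ - 1ℤ - + x
      0≤d-1-x = subst (0ℤ ≤_) (identity₃ δ (+ x)) (ℤₚ.i≤j⇒0≤j-i (ℤ.+≤+ x<d))
        where
        identity₃ : ∀ δ x → δ - (1ℤ + x) ≡ δ - 1ℤ - x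
        identity₃ = solve-∀
      identity₁ : ∀ δ b a x →
                  (- a + 1ℤ) - (((1ℤ - b) + - a * δ) - (- a + 1ℤ) * δ + (δ - 1ℤ - x)) * δ ≡
                  1ℤ - (a - (b + x) * δ)
      identity₁ = solve-∀
      identity₂ : ∀ δ b a x → ((1ℤ - b) + - a * δ) - (- a + 1ℤ) * δ + (δ - 1ℤ - x) ≡ - (b + x)
      identity₂ = solve-∀

    -- 1 − (z/α + d)/α = (1 − z)/α², because α² = d·α + 1.
    inUnitInterval-d : ∀ {z} → InUnitInterval z → InUnitInterval ((z /α +ℤ δ) /α)
    inUnitInterval-d {z@(⟨ b , a ⟩)} (z≥0 , 1-z>0) =
      nonNegative-/α (nonNegative-+ℤ 1≤d (nonNegative-/α z≥0) (ℤ.+≤+ z≤n)) ,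
      subst Positive (cong₂ ⟨_,_⟩ (identity₁ δ b a) (identity₂ δ b a)) (positive-/α (positive-/α 1-z>0))
      where
      identity₁ : ∀ δ b a → (1ℤ - b) - (- a - (1ℤ - b) * δ) * δ ≡ 1ℤ - (b - (a - b * δ + δ) * δ)
      identity₁ = solve-∀
      identity₂ : ∀ δ b a → - a - (1ℤ - b) * δ ≡ - (a - b * δ + δ)
      identity₂ = solve-∀

    θ-valid : ∀ {xs} → Valid d xs → InUnitInterval (θ xs)
    θ-valid nil = inUnitInterval-0
    θ-valid (last {x} x≤d _) with ℕₚ.m≤n⇒m<n∨m≡n x≤d
    ... | inj₁ x<d  = subst InUnitInterval (sym (θ-∷ x [])) (inUnitInterval-digit x<d inUnitInterval-0)
    ... | inj₂ refl = subst InUnitInterval (sym (θ-∷ d [])) (inUnitInterval-d inUnitInterval-0)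
    θ-valid (cons {x} {y} {ys} x≤d x≡d⇒y≡0 v) with ℕₚ.m≤n⇒m<n∨m≡n x≤d
    ... | inj₁ x<d  = subst InUnitInterval (sym (θ-∷ x (y ∷ ys))) (inUnitInterval-digit x<d (θ-valid v))
    ... | inj₂ refl with x≡d⇒y≡0 refl | v
    ...   | refl | last _ 0≢0  = ⊥-elim (0≢0 refl)
    ...   | refl | cons _ _ v′ = subst InUnitInterval (sym (θ-d∷0∷ ys)) (inUnitInterval-d (θ-valid v′))

    nutValue-isCeiling : ∀ {xs} → Valid d xs → IsCeilNegNAlpha d (value d xs) (nutValue d xs)
    nutValue-isCeiling {xs} valid with θ-valid valid
    ... | θ≥0 , 1-θ>0 = nonNegative⇒SqrtLe θ≥0 ,
      subst₂ (λ a b → SqrtLt a (d ℕ.* d ℕ.+ 4) b) (ℤₚ.neg-involutive (value d xs))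
        (identity δ (value d xs) (nutValue d xs)) (positive⇒SqrtLt 1-θ>0)
      where
      identity : ∀ δ n m → + 2 * (1ℤ - m) + - n * δ ≡ + 2 - n * δ - + 2 * m
      identity = solve-∀

Covers : (ℤ → Set) → ℤ → ℤ → Set
Covers S lo hi = ∀ {N} → lo ≤ N → N ≤ hi → S N

covers-shift : ∀ {S lo hi} c → Covers S (lo - c) (hi - c) → Covers (λ N → S (N - c)) lo hi
covers-shift c cover lo≤N N≤hi = cover (ℤₚ.+-monoˡ-≤ (- c) lo≤N) (ℤₚ.+-monoˡ-≤ (- c) N≤hi)

module _ (T : ℕ → ℤ → Set) (T-mono : ∀ {y N} → T y N → T (suc y) N) {w lo hi : ℤ} where

  covers-upward : ∀ Y → Covers (T 0) lo hi →
    (∀ y → y ℕ.< Y → Covers (T (suc y)) (1ℤ + (hi + + y * w)) (hi + + suc y * w)) →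
    Covers (T Y) lo (hi + + Y * w)
  covers-upward zero    base _ lo≤N N≤ = base lo≤N (subst (_ ≤_) (ℤₚ.+-identityʳ hi) N≤)
  covers-upward (suc Y) base step {N} lo≤N N≤ with N ℤₚ.≤? hi + + Y * w
  ... | yes N≤′ = T-mono (covers-upward Y base (λ y y<Y → step y (ℕₚ.m<n⇒m<1+n y<Y)) lo≤N N≤′)
  ... | no  N≰  = step Y (ℕₚ.n<1+n Y) (ℤₚ.i<j⇒suc[i]≤j (ℤₚ.≰⇒> N≰)) N≤

  covers-downward : ∀ Y → Covers (T 0) lo hi →
    (∀ y → y ℕ.< Y → Covers (T (suc y)) (lo - + suc y * w) (-1ℤ + (lo - + y * w))) →
    Covers (T Y) (lo - + Y * w) hi
  covers-downward zero    base _ lo≤N N≤ = base (subst (_≤ _) (ℤₚ.+-identityʳ lo) lo≤N) N≤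
  covers-downward (suc Y) base step {N} lo≤N N≤ with lo - + Y * w ℤₚ.≤? N
  ... | yes ≤N = T-mono (covers-downward Y base (λ y y<Y → step y (ℕₚ.m<n⇒m<1+n y<Y)) ≤N N≤)
  ... | no  ≰N = step Y (ℕₚ.n<1+n Y) lo≤N (ℤₚ.i<j⇒i≤pred[j] (ℤₚ.≰⇒> ≰N))

module Existence (d : ℕ) where
  open import Data.List using (_++_; _∷ʳ_; length)
  open import Data.List.Properties using (length-++; ++-assoc)

  -- Like Valid, except that trailing zeros are allowed; k is the length of xs and ℓ its last
  -- digit (0 for the empty list).
  data Admissible : ℕ → ℕ → List ℕ → Set where
    empty : Admissible 0 0 []
    snoc  : ∀ {k ℓ xs y} → Admissible k ℓ xs → y ℕ.≤ d → (ℓ ≡ d → y ≡ 0) →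
            Admissible (suc k) y (xs ∷ʳ y)

  admissible-length : ∀ {k ℓ xs} → Admissible k ℓ xs → length xs ≡ k
  admissible-length empty = refl
  admissible-length (snoc {xs = xs} a _ _) =
    trans (length-++ xs) (trans (ℕₚ.+-comm (length xs) 1) (cong suc (admissible-length a)))

  valueFrom-∷ʳ : ∀ j xs y →
                 valueFrom d j (xs ∷ʳ y) ≡ valueFrom d j xs + + y * Dneg d (j ℕ.+ length xs)
  valueFrom-∷ʳ j []       y =
    trans (ℤₚ.+-comm (+ y * Dneg d j) 0ℤ) (cong (λ i → 0ℤ + + y * Dneg d i) (sym (ℕₚ.+-identityʳ j)))
  valueFrom-∷ʳ j (x ∷ xs) y = begin
    + x * Dneg d j + valueFrom d (suc j) (xs ∷ʳ y)
      ≡⟨ cong (λ v → + x * Dneg d j + v) (valueFrom-∷ʳ (suc j) xs y) ⟩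
    + x * Dneg d j + (valueFrom d (suc j) xs + + y * Dneg d (suc j ℕ.+ length xs))
      ≡⟨ ℤₚ.+-assoc (+ x * Dneg d j) _ _ ⟨
    + x * Dneg d j + valueFrom d (suc j) xs + + y * Dneg d (suc j ℕ.+ length xs)
      ≡⟨ cong (λ i → + x * Dneg d j + valueFrom d (suc j) xs + + y * Dneg d i)
              (ℕₚ.+-suc j (length xs)) ⟨
    + x * Dneg d j + valueFrom d (suc j) xs + + y * Dneg d (j ℕ.+ suc (length xs)) ∎
    where open ≡-Reasoning

  value-∷ʳ : ∀ {k ℓ xs} → Admissible k ℓ xs → ∀ y →
             value d (xs ∷ʳ y) ≡ value d xs + + y * Dneg d (suc k)
  value-∷ʳ {xs = xs} a y = trans (valueFrom-∷ʳ 1 xs y)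
    (cong (λ k → value d xs + + y * Dneg d (suc k)) (admissible-length a))

  admissible-++-valid : ∀ {k ℓ xs z zs} → Admissible k ℓ xs → Valid d (z ∷ zs) →
                        (ℓ ≡ d → z ≡ 0) → Valid d (xs ++ z ∷ zs)
  admissible-++-valid empty valid _ = valid
  admissible-++-valid {z = z} {zs} (snoc {xs = xs} {y} a y≤d ℓ≡d⇒y≡0) valid y≡d⇒z≡0 =
    subst (Valid d) (sym (++-assoc xs (y ∷ []) (z ∷ zs)))
      (admissible-++-valid a (cons y≤d y≡d⇒z≡0 valid) ℓ≡d⇒y≡0)

  drop-trailing-zeros : ∀ {k ℓ xs} → Admissible k ℓ xs →
                        Σ (List ℕ) λ ys → Valid d ys × value d ys ≡ value d xs
  drop-trailing-zeros empty = [] , nil , refl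
  drop-trailing-zeros (snoc {y = zero} a _ _) with drop-trailing-zeros a
  ... | ys , valid , ys≡xs = ys , valid , trans ys≡xs (sym (trans (value-∷ʳ a 0) (ℤₚ.+-identityʳ _)))
  drop-trailing-zeros (snoc {xs = xs} {y = suc _} a y≤d ℓ≡d⇒y≡0) =
    xs ∷ʳ _ , admissible-++-valid a (last y≤d (λ ())) ℓ≡d⇒y≡0 , refl

  data Rep (k Y : ℕ) (N : ℤ) : Set where
    rep : ∀ {ℓ xs} → Admissible k ℓ xs → ℓ ℕ.≤ Y → value d xs ≡ N → Rep k Y N

  Rep⇒valid : ∀ {k Y N} → Rep k Y N → Σ (List ℕ) λ ds → Valid d ds × value d ds ≡ N
  Rep⇒valid (rep a _ v≡N) with drop-trailing-zeros a
  ... | ys , valid , ys≡xs = ys , valid , trans ys≡xs v≡N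

  Rep-mono : ∀ {k Y N} → Rep k Y N → Rep k (suc Y) N
  Rep-mono (rep a ℓ≤Y v≡N) = rep a (ℕₚ.m≤n⇒m≤1+n ℓ≤Y) v≡N

  Rep-∷ʳ0 : ∀ {k Y N} → Rep k Y N → Rep (suc k) 0 N
  Rep-∷ʳ0 (rep a _ v≡N) =
    rep (snoc a z≤n (λ _ → refl)) z≤n (trans (value-∷ʳ a 0) (trans (ℤₚ.+-identityʳ _) v≡N))

  Rep-∷ʳ : 1 ℕ.≤ d → ∀ {k y N} → y ℕ.≤ d → Rep k (d ∸ 1) (N - + y * Dneg d (suc k)) →
           Rep (suc k) y N
  Rep-∷ʳ 1≤d {k} {y} {N} y≤d (rep a ℓ≤d-1 v≡N-yw) =
    rep (snoc a y≤d (λ ℓ≡d → ⊥-elim (ℕₚ.<⇒≱ d-1<d (subst (ℕ._≤ d ∸ 1) ℓ≡d ℓ≤d-1)))) ℕₚ.≤-refl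
      (trans (value-∷ʳ a y) (trans (cong (_+ yw) v≡N-yw) (identity N yw)))
    where
    yw : ℤ
    yw = + y * Dneg d (suc k)
    d-1<d : d ∸ 1 ℕ.< d
    d-1<d = ℕₚ.∸-monoʳ-< (s≤s z≤n) 1≤d
    identity : ∀ N c → N - c + c ≡ N
    identity = solve-∀

  +[d∸1]≡d-1 : 1 ℕ.≤ d → + (d ∸ 1) ≡ + d - 1ℤ
  +[d∸1]≡d-1 1≤d = trans (sym (ℤₚ.⊖-≥ 1≤d)) (sym (ℤₚ.m-n≡m⊖n d 1))

  module _ (1≤d : 1 ℕ.≤ d) {k : ℕ} {w lo hi : ℤ} (all : Covers (Rep k d) lo hi) where

    covers-step↑ : Dneg d (suc k) ≡ w → Covers (Rep k (d ∸ 1)) (hi + 1ℤ - w) hi →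
                   ∀ Y → Y ℕ.≤ d → Covers (Rep (suc k) Y) lo (hi + + Y * w)
    covers-step↑ refl lower Y Y≤d =
      covers-upward (Rep (suc k)) Rep-mono Y (λ l u → Rep-∷ʳ0 (all l u))
        (λ y y<Y l u → Rep-∷ʳ 1≤d (ℕₚ.≤-trans y<Y Y≤d)
          (covers-shift (+ suc y * w) (subst₂ (Covers _) (e₁ hi w (+ y)) (e₂ hi w (+ y)) lower) l u))
      where
      e₁ : ∀ hi w y → hi + 1ℤ - w ≡ 1ℤ + (hi + y * w) - (1ℤ + y) * w
      e₁ = solve-∀
      e₂ : ∀ hi w y → hi ≡ hi + (1ℤ + y) * w - (1ℤ + y) * w
      e₂ = solve-∀

    covers-step↓ : Dneg d (suc k) ≡ - w → Covers (Rep k (d ∸ 1)) lo (lo - 1ℤ + w) →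
                   ∀ Y → Y ℕ.≤ d → Covers (Rep (suc k) Y) (lo - + Y * w) hi
    covers-step↓ D≡-w lower Y Y≤d =
      covers-downward (Rep (suc k)) Rep-mono Y (λ l u → Rep-∷ʳ0 (all l u))
        (λ y y<Y {N} l u → Rep-∷ʳ 1≤d (ℕₚ.≤-trans y<Y Y≤d)
          (subst (λ D → Rep k (d ∸ 1) (N - + suc y * D)) (sym D≡-w)
            (covers-shift (+ suc y * - w) (subst₂ (Covers _) (e₁ lo w (+ y)) (e₂ lo w (+ y)) lower) l u)))
      where
      e₁ : ∀ lo w y → lo ≡ lo - (1ℤ + y) * w - (1ℤ + y) * - w
      e₁ = solve-∀
      e₂ : ∀ lo w y → lo - 1ℤ + w ≡ -1ℤ + (lo - y * w) - (1ℤ + y) * - w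
      e₂ = solve-∀

  P : ℕ → ℤ
  P = Dpos d

  data Cover (k : ℕ) : Set where
    even-length : Dneg d k ≡ - P k → Dneg d (suc k) ≡ P (suc k) →
                  Covers (Rep k d) (1ℤ - P (suc k)) (P k) →
                  Covers (Rep k (d ∸ 1)) (1ℤ - P (suc k) + P k) (P k) → Cover k
    odd-length  : Dneg d k ≡ P k → Dneg d (suc k) ≡ - P (suc k) →
                  Covers (Rep k d) (1ℤ - P k) (P (suc k)) →
                  Covers (Rep k (d ∸ 1)) (1ℤ - P k) (P (suc k) - P k) → Cover k

  cover-suc : 1 ℕ.≤ d → ∀ {k} → Cover k → Cover (suc k)
  cover-suc 1≤d {k} (even-length D₀ D₁ all lower) = odd-length D₁ D₂
    (subst (Covers (Rep (suc k) d) (1ℤ - p₁)) (e₂ δ p₀ p₁) (step d ℕₚ.≤-refl))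
    (subst (Covers (Rep (suc k) (d ∸ 1)) (1ℤ - p₁))
      (trans (cong (λ c → p₀ + c * p₁) (+[d∸1]≡d-1 1≤d)) (e₃ δ p₀ p₁)) (step (d ∸ 1) (ℕₚ.m∸n≤m d 1)))
    where
    δ p₀ p₁ : ℤ
    δ = + d
    p₀ = P k
    p₁ = P (suc k)
    e₁ : ∀ δ p₀ p₁ → - p₀ - δ * p₁ ≡ - (δ * p₁ + p₀)
    e₁ = solve-∀
    e₂ : ∀ δ p₀ p₁ → p₀ + δ * p₁ ≡ δ * p₁ + p₀
    e₂ = solve-∀
    e₃ : ∀ δ p₀ p₁ → p₀ + (δ - 1ℤ) * p₁ ≡ δ * p₁ + p₀ - p₁
    e₃ = solve-∀
    e₄ : ∀ p₀ p₁ → 1ℤ - p₁ + p₀ ≡ p₀ + 1ℤ - p₁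
    e₄ = solve-∀
    D₂ : Dneg d (suc (suc k)) ≡ - P (suc (suc k))
    D₂ = trans (cong₂ (λ a b → a - δ * b) D₀ D₁) (e₁ δ p₀ p₁)
    step : ∀ Y → Y ℕ.≤ d → Covers (Rep (suc k) Y) (1ℤ - p₁) (p₀ + + Y * p₁)
    step = covers-step↑ 1≤d all D₁ (subst (λ lo → Covers (Rep k (d ∸ 1)) lo p₀) (e₄ p₀ p₁) lower)
  cover-suc 1≤d {k} (odd-length D₀ D₁ all lower) = even-length D₁ D₂
    (subst (λ lo → Covers (Rep (suc k) d) lo p₁) (e₂ δ p₀ p₁) (step d ℕₚ.≤-refl))
    (subst (λ lo → Covers (Rep (suc k) (d ∸ 1)) lo p₁)
      (trans (cong (λ c → 1ℤ - p₀ - c * p₁) (+[d∸1]≡d-1 1≤d)) (e₃ δ p₀ p₁)) (step (d ∸ 1) (ℕₚ.m∸n≤m d 1)))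
    where
    δ p₀ p₁ : ℤ
    δ = + d
    p₀ = P k
    p₁ = P (suc k)
    e₁ : ∀ δ p₀ p₁ → p₀ - δ * - p₁ ≡ δ * p₁ + p₀
    e₁ = solve-∀
    e₂ : ∀ δ p₀ p₁ → 1ℤ - p₀ - δ * p₁ ≡ 1ℤ - (δ * p₁ + p₀)
    e₂ = solve-∀
    e₃ : ∀ δ p₀ p₁ → 1ℤ - p₀ - (δ - 1ℤ) * p₁ ≡ 1ℤ - (δ * p₁ + p₀) + p₁
    e₃ = solve-∀
    e₄ : ∀ p₀ p₁ → p₁ - p₀ ≡ 1ℤ - p₀ - 1ℤ + p₁
    e₄ = solve-∀
    D₂ : Dneg d (suc (suc k)) ≡ P (suc (suc k))
    D₂ = trans (cong₂ (λ a b → a - δ * b) D₀ D₁) (e₁ δ p₀ p₁)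
    step : ∀ Y → Y ℕ.≤ d → Covers (Rep (suc k) Y) (1ℤ - p₀ - + Y * p₁) p₁
    step = covers-step↓ 1≤d all D₁ (subst (Covers (Rep k (d ∸ 1)) (1ℤ - p₀)) (e₄ p₀ p₁) lower)

  cover : 1 ℕ.≤ d → ∀ k → Cover k
  cover _   zero    = even-length refl refl covers-[] covers-[]
    where
    covers-[] : ∀ {Y} → Covers (Rep 0 Y) 0ℤ 0ℤ
    covers-[] 0≤N N≤0 = rep empty z≤n (ℤₚ.≤-antisym 0≤N N≤0)
  cover 1≤d (suc k) = cover-suc 1≤d (cover 1≤d k)

  n<P[1+n] : 2 ℕ.≤ d → ∀ n → + n < P (suc n)
  n<P[1+n] _   zero    = +<+ (s≤s z≤n)
  n<P[1+n] 2≤d (suc n) = begin-strict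
    + suc n        ≤⟨ ℤₚ.i<j⇒suc[i]≤j IH ⟩
    p₁             ≡⟨ ℤₚ.+-identityʳ p₁ ⟨
    p₁ + 0ℤ        <⟨ ℤₚ.+-monoʳ-< p₁ 0<p₁ ⟩
    p₁ + p₁        ≡⟨ double p₁ ⟩
    + 2 * p₁       ≤⟨ ℤₚ.*-monoʳ-≤-nonNeg p₁ {{ℤ.nonNegative (ℤₚ.<⇒≤ 0<p₁)}} (ℤ.+≤+ 2≤d) ⟩
    + d * p₁       ≤⟨ ℤₚ.i≤i+j (+ d * p₁) (P n) {{ℤ.nonNegative (0≤P n)}} ⟩
    + d * p₁ + P n ∎
    where
    open ℤₚ.≤-Reasoning
    p₁ : ℤ
    p₁ = P (suc n)
    IH : + n < p₁
    IH = n<P[1+n] 2≤d n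
    0<p₁ : 0ℤ < p₁
    0<p₁ = ℤₚ.≤-<-trans (ℤ.+≤+ z≤n) IH
    double : ∀ p → p + p ≡ + 2 * p
    double = solve-∀
    0≤P : ∀ m → 0ℤ ≤ P m
    0≤P zero    = ℤₚ.≤-refl
    0≤P (suc m) = ℤₚ.<⇒≤ (ℤₚ.≤-<-trans (ℤ.+≤+ z≤n) (n<P[1+n] 2≤d m))

  existence : 2 ℕ.≤ d → ∀ N → Σ (List ℕ) λ ds → Valid d ds × value d ds ≡ N
  existence 2≤d N = Rep⇒valid (covered (cover (ℕₚ.≤-trans (s≤s z≤n) 2≤d) (suc m)))
    where
    m : ℕ
    m = ∣ N ∣
    within₁ : 1ℤ - P (suc m) ≤ N × N ≤ P (suc m)
    within₁ = ∣i∣<j⇒1-j≤i≤j N (n<P[1+n] 2≤d m)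
    within₂ : 1ℤ - P (suc (suc m)) ≤ N × N ≤ P (suc (suc m))
    within₂ = ∣i∣<j⇒1-j≤i≤j N (ℤₚ.≤-<-trans (ℤ.+≤+ (ℕₚ.n≤1+n m)) (n<P[1+n] 2≤d (suc m)))
    covered : Cover (suc m) → Rep (suc m) d N
    covered (even-length _ _ all _) = all (proj₁ within₂) (proj₂ within₁)
    covered (odd-length  _ _ all _) = all (proj₁ within₁) (proj₂ within₂)

open NutValue using (nutValue-isCeiling)
open Existence using (existence)

lemma3 : (d : ℕ) → d ≥ 2 → (n : ℤ) →
    Σ (List ℕ) (λ ds → Valid d ds × value d ds ≡ n)
    × ((ds : List ℕ) → Valid d ds → value d ds ≡ n →
        IsCeilNegNAlpha d n (nutValue d ds))
lemma3 d 2≤d n = existence d 2≤d n , nut≡ceiling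
  where
  nut≡ceiling : (ds : List ℕ) → Valid d ds → value d ds ≡ n → IsCeilNegNAlpha d n (nutValue d ds)
  nut≡ceiling ds valid refl = nutValue-isCeiling d (ℕₚ.≤-trans (s≤s z≤n) 2≤d) valid
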